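{- Let $(A,\leq,{}',0,1)$ be a finite orthomodular poset, $T$ a nonempty set and $p,q\in A^T$. Then (i) $p\leq q\rightarrow(p\odot q)$ and (ii) $(p\rightarrow q)\odot p\leq q$.
   Context: An orthomodular poset is a bounded poset $(A,\leq,0,1)$ with a unary operation ${}'$ that is an antitone involution and a complementation ($a\vee a'=1$, $a\wedge a'=0$), such that if $x\leq y'$ then $x\vee y$ exists, and if $x\leq y$ then $y=x\vee(y\wedge x')$. For $B\subseteq A$: $L(B)$, $U(B)$ are the sets of lower and upper bounds; $\operatorname{Max}B$, $\operatorname{Min}B$ the sets of maximal and minimal elements; $a\vee B=\{a\vee b\mid b\in B\}$, $B\wedge a=\{b\wedge a\mid b\in B\}$. For $a,b\in A$: $a\odot b:=\operatorname{Min}U(\{a,b'\})\wedge b$, $a\rightarrow b:=a'\vee\operatorname{Max}L(\{a,b\})$ (always defined, nonempty subsets of $A$). For nonempty $B,C\subseteq A$: $B\odot C=\bigcup\{b\odot c\mid b\in B,c\in C\}$, $B\rightarrow C=\bigcup\{b\rightarrow c\mid b\in B,c\in C\}$; elements $a$ are identified with $\{a\}$. For $x,y\in(2^A\setminus\{\emptyset\})^T$ (with $p\in A^T$ identified with $t\mapsto\{p(t)\}$): $(x\odot y)(t)=x(t)\odot y(t)$, $(x\rightarrow y)(t)=x(t)\rightarrow y(t)$, and $x\leq y$ iff for every $t\in T$, $b\leq c$ for all $b\in x(t)$, $c\in y(t)$. -}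

module Defs where

open import Level using (0ℓ)
open import Data.Product using (Σ; ∃; _×_; _,_)
open import Data.Sum using (_⊎_)
open import Data.List using (List)
open import Data.List.Membership.Propositional using (_∈_)
open import Relation.Binary.PropositionalEquality using (_≡_)
open import Relation.Binary.Structures using (IsPartialOrder)

Subset : Set → Set₁
Subset A = A → Set

module PosetNotions {A : Set} (_≤_ : A → A → Set) where
  L : Subset A → Subset A
  L B x = ∀ b → B b → x ≤ b
  U : Subset A → Subset A
  U B x = ∀ b → B b → b ≤ x
  Max : Subset A → Subset A
  Max B x = B x × (∀ y → B y → x ≤ y → y ≡ x)
  Min : Subset A → Subset A
  Min B x = B x × (∀ y → B y → y ≤ x → y ≡ x)
  pair : A → A → Subset A
  pair a b z = (z ≡ a) ⊎ (z ≡ b)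
  IsJoin : A → A → A → Set
  IsJoin a b m = U (pair a b) m × (∀ u → U (pair a b) u → m ≤ u)
  IsMeet : A → A → A → Set
  IsMeet a b m = L (pair a b) m × (∀ l → L (pair a b) l → l ≤ m)

record OrthomodularPoset : Set₁ where
  field
    Carrier : Set
    _≤_ : Carrier → Carrier → Set
    isPartialOrder : IsPartialOrder _≡_ _≤_
    𝟘 𝟙 : Carrier
    𝟘-least : ∀ x → 𝟘 ≤ x
    𝟙-greatest : ∀ x → x ≤ 𝟙
    _′ : Carrier → Carrier
  open PosetNotions _≤_ public
  field
    antitone : ∀ x y → x ≤ y → (y ′) ≤ (x ′)
    involutive : ∀ x → (x ′) ′ ≡ x
    compl-join : ∀ a → IsJoin a (a ′) 𝟙
    compl-meet : ∀ a → IsMeet a (a ′) 𝟘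
    orth-join : ∀ x y → x ≤ (y ′) → ∃ λ j → IsJoin x y j
    orthomodular : ∀ x y → x ≤ y → ∃ λ m → IsMeet y (x ′) m × IsJoin x m y

  _⊙_ : Carrier → Carrier → Subset Carrier
  (a ⊙ b) x = ∃ λ c → Min (U (pair a (b ′))) c × IsMeet c b x

  _⇒_ : Carrier → Carrier → Subset Carrier
  (a ⇒ b) x = ∃ λ d → Max (L (pair a b)) d × IsJoin (a ′) d x

  _⊙ˢ_ : Subset Carrier → Subset Carrier → Subset Carrier
  (B ⊙ˢ C) x = ∃ λ b → ∃ λ c → B b × C c × (b ⊙ c) x
  _⇒ˢ_ : Subset Carrier → Subset Carrier → Subset Carrier
  (B ⇒ˢ C) x = ∃ λ b → ∃ λ c → B b × C c × (b ⇒ c) x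

  ｛_｝ : Carrier → Subset Carrier
  ｛ a ｝ x = x ≡ a

  module _ {T : Set} where
    _⊙ᵀ_ : (T → Subset Carrier) → (T → Subset Carrier) → T → Subset Carrier
    (x ⊙ᵀ y) t = x t ⊙ˢ y t
    _⇒ᵀ_ : (T → Subset Carrier) → (T → Subset Carrier) → T → Subset Carrier
    (x ⇒ᵀ y) t = x t ⇒ˢ y t
    _≤ᵀ_ : (T → Subset Carrier) → (T → Subset Carrier) → Set
    x ≤ᵀ y = ∀ t → ∀ b c → x t b → y t c → b ≤ c
    ↑ : (T → Carrier) → T → Subset Carrier
    ↑ p t = ｛ p t ｝

Finite : OrthomodularPoset → Set
Finite P = Σ (List Carrier) λ xs → ∀ a → a ∈ xs
  where open OrthomodularPoset P

-- Both inequalities reduce to one element of A.  For (i), if w = c ∧ b with c ∈ Min U{a, b′},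
-- then w ≤ b forces Max L{b, w} = {w}, so b → w = b′ ∨ w, and this is c by orthomodularity
-- (b′ ≤ c); hence a ≤ c = b → w.  For (ii), if w = a′ ∨ d with d ∈ Max L{a, b}, then
-- a′ ≤ w forces Min U{w, a′} = {w}, so w ⊙ a = w ∧ a =: z.  Orthomodularity gives
-- z = d ∨ m with m = z ∧ d′; but m ≤ z ≤ w ≤ m′ (as m ≤ a, d′), so m = 0 and z = d ≤ b.
module Submission where

open import Defs
open import Data.Product using (∃; _×_; _,_; proj₁; proj₂)
open import Data.Sum using (inj₁; inj₂)
open import Relation.Binary.Bundles using (Poset)
open import Relation.Binary.PropositionalEquality using (_≡_; refl; sym; subst)
open import Relation.Binary.Structures using (IsPartialOrder)
import Relation.Binary.Reasoning.PartialOrder as PosetReasoning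

module OrthomodularPosetProperties (P : OrthomodularPoset) where
  open OrthomodularPoset P
  open IsPartialOrder isPartialOrder using (trans; antisym) renaming (refl to ≤-refl)

  poset : Poset _ _ _
  poset = record { isPartialOrder = isPartialOrder }

  open PosetReasoning poset

  variable
    a b c d j n x y : Carrier

  join-upperˡ : IsJoin a b j → a ≤ j
  join-upperˡ (upper , _) = upper _ (inj₁ refl)

  join-upperʳ : IsJoin a b j → b ≤ j
  join-upperʳ (upper , _) = upper _ (inj₂ refl)

  join-least : IsJoin a b j → a ≤ x → b ≤ x → j ≤ x
  join-least (_ , least) a≤x b≤x = least _ λ { _ (inj₁ refl) → a≤x ; _ (inj₂ refl) → b≤x }

  meet-lowerˡ : IsMeet a b n → n ≤ a
  meet-lowerˡ (lower , _) = lower _ (inj₁ refl)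

  meet-lowerʳ : IsMeet a b n → n ≤ b
  meet-lowerʳ (lower , _) = lower _ (inj₂ refl)

  meet-greatest : IsMeet a b n → x ≤ a → x ≤ b → x ≤ n
  meet-greatest (_ , greatest) x≤a x≤b = greatest _ λ { _ (inj₁ refl) → x≤a ; _ (inj₂ refl) → x≤b }

  join-unique : IsJoin a b j → IsJoin a b x → j ≡ x
  join-unique j-join x-join =
    antisym (join-least j-join (join-upperˡ x-join) (join-upperʳ x-join))
            (join-least x-join (join-upperˡ j-join) (join-upperʳ j-join))

  meet-unique : IsMeet a b n → IsMeet a b x → n ≡ x
  meet-unique n-meet x-meet =
    antisym (meet-greatest x-meet (meet-lowerˡ n-meet) (meet-lowerʳ n-meet))
            (meet-greatest n-meet (meet-lowerˡ x-meet) (meet-lowerʳ x-meet))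

  Max-L-pair-≥ : y ≤ x → Max (L (pair x y)) d → d ≡ y
  Max-L-pair-≥ y≤x (d-lower , maximal) =
    sym (maximal _ (λ { _ (inj₁ refl) → y≤x ; _ (inj₂ refl) → ≤-refl })
                   (d-lower _ (inj₂ refl)))

  Min-U-pair-≥ : y ≤ x → Min (U (pair x y)) c → c ≡ x
  Min-U-pair-≥ y≤x (c-upper , minimal) =
    sym (minimal _ (λ { _ (inj₁ refl) → ≤-refl ; _ (inj₂ refl) → y≤x })
                   (c-upper _ (inj₁ refl)))

  orthomodular-law : x ≤ y → IsMeet y (x ′) n → IsJoin x n y
  orthomodular-law {x} {y} x≤y n-meet with orthomodular x y x≤y
  ... | m₀ , m₀-meet , m₀-join = subst (λ v → IsJoin x v y) (meet-unique m₀-meet n-meet) m₀-join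

  ≤′-sym : x ≤ (y ′) → y ≤ (x ′)
  ≤′-sym {x} {y} x≤y′ = subst (_≤ (x ′)) (involutive y) (antitone x (y ′) x≤y′)

  ≤′⇒≤𝟘 : x ≤ (x ′) → x ≤ 𝟘
  ≤′⇒≤𝟘 x≤x′ = meet-greatest (compl-meet _) ≤-refl x≤x′

  ⊙-⇒-unit : (a ⊙ b) x → (b ⇒ x) y → a ≤ y
  ⊙-⇒-unit {a} {b} {w} {z} (c , (c-upper , _) , w-meet) (_ , d-max , z-join) = begin
    a ≤⟨ c-upper a (inj₁ refl) ⟩
    c ≡⟨ join-unique c-join z-join′ ⟩
    z ∎
    where
    w-meet′ : IsMeet c (b ′ ′) w
    w-meet′ = subst (λ v → IsMeet c v w) (sym (involutive b)) w-meet

    c-join : IsJoin (b ′) w c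
    c-join = orthomodular-law (c-upper (b ′) (inj₂ refl)) w-meet′

    z-join′ : IsJoin (b ′) w z
    z-join′ = subst (λ v → IsJoin (b ′) v z) (Max-L-pair-≥ (meet-lowerʳ w-meet) d-max) z-join

  ⇒-⊙-modusPonens : (a ⇒ b) x → (x ⊙ a) y → y ≤ b
  ⇒-⊙-modusPonens {a} {b} {w} {z} (d , (d-lower , _) , w-join) (_ , c-min , z-meet) = begin
    z ≤⟨ join-least z-join ≤-refl (trans m≤𝟘 (𝟘-least d)) ⟩
    d ≤⟨ d-lower b (inj₂ refl) ⟩
    b ∎
    where
    z-meet′ : IsMeet w a z
    z-meet′ = subst (λ v → IsMeet v a z) (Min-U-pair-≥ (join-upperˡ w-join) c-min) z-meet

    d≤z : d ≤ z
    d≤z = meet-greatest z-meet′ (join-upperʳ w-join) (d-lower a (inj₁ refl))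

    z-decomposition : ∃ λ m → IsMeet z (d ′) m × IsJoin d m z
    z-decomposition = orthomodular d z d≤z

    m : Carrier
    m = proj₁ z-decomposition

    m-meet : IsMeet z (d ′) m
    m-meet = proj₁ (proj₂ z-decomposition)

    z-join : IsJoin d m z
    z-join = proj₂ (proj₂ z-decomposition)

    m≤z : m ≤ z
    m≤z = meet-lowerˡ m-meet

    w≤m′ : w ≤ (m ′)
    w≤m′ = join-least w-join (antitone m a (trans m≤z (meet-lowerʳ z-meet′)))
                             (≤′-sym (meet-lowerʳ m-meet))

    m≤𝟘 : m ≤ 𝟘
    m≤𝟘 = ≤′⇒≤𝟘 (begin m ≤⟨ m≤z ⟩ z ≤⟨ meet-lowerˡ z-meet′ ⟩ w ≤⟨ w≤m′ ⟩ (m ′) ∎)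

-- Finiteness of A and nonemptiness of T only make the sets involved nonempty; the
-- inequalities themselves hold element by element without them.
lemma3 : (P : OrthomodularPoset) → Finite P → (T : Set) → T →
    let open OrthomodularPoset P in
    (p q : T → Carrier) →
    (↑ p ≤ᵀ (↑ q ⇒ᵀ (↑ p ⊙ᵀ ↑ q))) × (((↑ p ⇒ᵀ ↑ q) ⊙ᵀ ↑ p) ≤ᵀ ↑ q)
lemma3 P _ T _ p q = unit , modusPonens
  where
  open OrthomodularPoset P
  open OrthomodularPosetProperties P

  unit : ↑ p ≤ᵀ (↑ q ⇒ᵀ (↑ p ⊙ᵀ ↑ q))
  unit t _ z refl (_ , w , refl , (_ , _ , refl , refl , w∈p⊙q) , z∈q⇒w) =
    ⊙-⇒-unit w∈p⊙q z∈q⇒w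

  modusPonens : ((↑ p ⇒ᵀ ↑ q) ⊙ᵀ ↑ p) ≤ᵀ ↑ q
  modusPonens t z _ (w , _ , (_ , _ , refl , refl , w∈p⇒q) , refl , z∈w⊙p) refl =
    ⇒-⊙-modusPonens w∈p⇒q z∈w⊙p
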